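{- Let $M=(m_{0},m_{1},m_{2},\ldots)$ be a sequence of integers with $m_{0}=1$ and $m_{j}\geq 2$ for all $j\geq 1$, and assume that for every $t\geq 1$ and every prime $p$, if $p\mid m_{t}$ then $p\geq t$. For $k\geq 0$ put $M_{k}=m_{0}m_{1}\cdots m_{k}$ and let $p_{M}(n)$ be the number of partitions of $n$ into parts of the form $M_{k}$. Then for every positive integers $n$ and $r$, \[ p_{M}(m_{1}m_{2}\cdots m_{r}n-1)\equiv 0 \pmod{\prod_{t=2}^{r}m_{t}}. \]
   Context: A partition of $n$ into parts of the form $M_k$ is a representation $n=M_{k_{1}}+\cdots+M_{k_{s}}$ with $k_{1}\leq\cdots\leq k_{s}$; the empty product equals $1$. -}

module Defs where

open import Data.Nat using (ℕ; zero; suc; _+_; _*_; _∸_; _≤_; _≤?_)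
open import Relation.Nullary using (yes; no)

Mprod : (ℕ → ℕ) → ℕ → ℕ
Mprod m zero    = m zero
Mprod m (suc k) = Mprod m k * m (suc k)

prodFrom : (ℕ → ℕ) → ℕ → ℕ → ℕ
prodFrom m i zero      = 1
prodFrom m i (suc len) = m i * prodFrom m (suc i) len

sumUpTo : ℕ → (ℕ → ℕ) → ℕ
sumUpTo zero    f = f zero
sumUpTo (suc b) f = sumUpTo b f + f (suc b)

-- partsUpTo m K n = number of partitions of n into parts from {M 0, ..., M K},
-- i.e. the number of multiplicity vectors (c 0, ..., c K) of naturals with
-- c 0 * M 0 + ... + c K * M K = n.  (Recursion on the multiplicity of the
-- largest-index part; multiplicities j range over 0..n, those with
-- j * M K > n contribute nothing.)
partsUpTo : (ℕ → ℕ) → ℕ → ℕ → ℕ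
partsUpTo m zero    n with Mprod m zero
... | d = countMult d n
  where
  -- number of c with c * d = n, for c ≤ n (or any c when d = 0 would be
  -- infinite; here d = M 0 = 1 under the hypotheses)
  countMult : ℕ → ℕ → ℕ
  countMult d n = sumUpTo n (λ c → check (c * d) n)
    where
    check : ℕ → ℕ → ℕ
    check a b with a Data.Nat.≟ b
    ... | yes _ = 1
    ... | no  _ = 0
partsUpTo m (suc K) n =
  sumUpTo n (λ j → fits (j * Mprod m (suc K)))
  where
  fits : ℕ → ℕ
  fits a with a ≤? n
  ... | yes _ = partsUpTo m K (n ∸ a)
  ... | no  _ = 0

-- p_M(n): partitions of n into parts of the form M k (k ≥ 0).
-- Since M k ≥ 2^k > k under the hypotheses, parts with k > n never occur,
-- so restricting to indices 0..n is exact.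
pM : (ℕ → ℕ) → ℕ → ℕ
pM m n = partsUpTo m n n

{-# OPTIONS --safe #-}
module Submission where

open import Defs
open import Data.Nat
open import Data.Nat.Properties
open import Data.Nat.Combinatorics using (_C_; nC1≡n; nCk+nC[k+1]≡[n+1]C[k+1])
open import Data.Nat.Coprimality using (Coprime; coprime-divisor)
open import Data.Nat.Divisibility using (_∣_; divides; ∣⇒≤; 0∣⇒≡0; _∣0; 1∣_)
open import Data.Nat.Divisibility.Core using (hasNonTrivialDivisor)
open import Data.Nat.Primality
open import Data.Nat.Induction using (<-wellFounded)
open import Data.Integer as ℤ using (ℤ; +_; 0ℤ; 1ℤ)
import Data.Integer.Properties as ℤ
open import Data.Integer.Divisibility.Signed as ℤ
  using (∣ᵤ⇒∣; ∣⇒∣ᵤ; ∣m∣n⇒∣m+n; ∣m∣n⇒∣m-n; ∣m⇒∣m*n; ∣n⇒∣m*n; *-monoʳ-∣)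
import Data.Integer.Tactic.RingSolver as ℤ-Solver
import Data.Nat.Tactic.RingSolver as ℕ-Solver
open import Data.Product using (_,_)
open import Data.Sum using (inj₁; inj₂; [_,_])
open import Induction.WellFounded using (Acc; acc)
open import Relation.Nullary using (yes; no; contradiction)
open import Relation.Binary.PropositionalEquality hiding ([_])

-- Let M′ = (1, m₂, m₃, …), so that M (k+1) = m₁ M′ k. Grouping the parts other than
-- M 0 = 1, which are all multiples of m₁, gives p_M (m₁ i + s) = Σ_{y ≤ i} p_M′ y for
-- s < m₁; hence p_M (m₁ Q n − 1), with Q = m₂ ⋯ m_r, is the sum of p_M′ over n blocks of
-- length Q, and it suffices that Q divides each block sum.
--
-- This is proved for weighted block sums Σ_{j < A} w j · p_a (A n + j), A = a₁ ⋯ a_r,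
-- where a₀ = 1, the prime factors of a_t are ≥ t + d and w is a polynomial of degree < d,
-- by induction on r. For A = a₁ Q the identity above turns the sum into Σ_{i < Q} W i · P i
-- with W i = Σ_{s < a₁} w (a₁ i + s) and P a prefix sum of p_a′. A number whose prime factors
-- all exceed d divides the sum of a polynomial of degree < d over a full period (expand
-- in binomials C(j, e) and use A ∣ C(A, e+1) for gcd(A, e+1) = 1), so W = a₁ V with V of
-- degree < d. Summation by parts rewrites Σ V i · P i through Σ_i V i and a block sum for
-- a′ with the weight Σ_{i < y} V i of degree < d + 1; a′ satisfies the hypothesis with
-- d + 1, so the induction hypothesis applies. All of this holds for partitions into parts
-- M 0, …, M K for every K, which is how p_M is computed.

∑< : ℕ → (ℕ → ℤ) → ℤ
∑< zero    f = 0ℤ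
∑< (suc n) f = ∑< n f ℤ.+ f n

infix 6.5 ∑<
syntax ∑< n (λ j → e) = ∑[ j < n ] e

∑-cong : ∀ n {f g : ℕ → ℤ} → (∀ j → j < n → f j ≡ g j) → ∑< n f ≡ ∑< n g
∑-cong zero    f≗g = refl
∑-cong (suc n) f≗g = cong₂ ℤ._+_ (∑-cong n (λ j j<n → f≗g j (m<n⇒m<1+n j<n))) (f≗g n ≤-refl)

∑-zero : ∀ n → ∑[ j < n ] 0ℤ ≡ 0ℤ
∑-zero zero    = refl
∑-zero (suc n) = trans (ℤ.+-identityʳ _) (∑-zero n)

∑-+ : ∀ n (f g : ℕ → ℤ) → ∑[ j < n ] (f j ℤ.+ g j) ≡ ∑< n f ℤ.+ ∑< n g
∑-+ zero    f g = refl
∑-+ (suc n) f g =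
  trans (cong (ℤ._+ (f n ℤ.+ g n)) (∑-+ n f g)) (shuffle (∑< n f) (∑< n g) (f n) (g n))
  where
  shuffle : ∀ a b c d → (a ℤ.+ b) ℤ.+ (c ℤ.+ d) ≡ (a ℤ.+ c) ℤ.+ (b ℤ.+ d)
  shuffle = ℤ-Solver.solve-∀

∑-*ˡ : ∀ n c (f : ℕ → ℤ) → ∑[ j < n ] (c ℤ.* f j) ≡ c ℤ.* ∑< n f
∑-*ˡ zero    c f = sym (ℤ.*-zeroʳ c)
∑-*ˡ (suc n) c f =
  trans (cong (ℤ._+ c ℤ.* f n) (∑-*ˡ n c f)) (sym (ℤ.*-distribˡ-+ c (∑< n f) (f n)))

∑-*ʳ : ∀ n c (f : ℕ → ℤ) → ∑[ j < n ] (f j ℤ.* c) ≡ ∑< n f ℤ.* c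
∑-*ʳ zero    c f = sym (ℤ.*-zeroˡ c)
∑-*ʳ (suc n) c f =
  trans (cong (ℤ._+ f n ℤ.* c) (∑-*ʳ n c f)) (sym (ℤ.*-distribʳ-+ c (∑< n f) (f n)))

∑-suc : ∀ n (f : ℕ → ℤ) → ∑< (suc n) f ≡ f 0 ℤ.+ ∑[ j < n ] f (suc j)
∑-suc zero    f = trans (ℤ.+-identityˡ (f 0)) (sym (ℤ.+-identityʳ (f 0)))
∑-suc (suc n) f = trans (cong (ℤ._+ f (suc n)) (∑-suc n f)) (ℤ.+-assoc (f 0) _ _)

∑-++ : ∀ x y (f : ℕ → ℤ) → ∑< (x + y) f ≡ ∑< x f ℤ.+ ∑[ s < y ] f (x + s)
∑-++ x zero    f = trans (cong (λ n → ∑< n f) (+-identityʳ x)) (sym (ℤ.+-identityʳ _))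
∑-++ x (suc y) f rewrite +-suc x y =
  trans (cong (ℤ._+ f (x + y)) (∑-++ x y f)) (ℤ.+-assoc (∑< x f) _ _)

∑-blocks : ∀ a b (f : ℕ → ℤ) → ∑< (a * b) f ≡ ∑[ i < b ] ∑[ s < a ] f (a * i + s)
∑-blocks a zero    f rewrite *-zeroʳ a = refl
∑-blocks a (suc b) f rewrite *-suc a b | +-comm a (a * b) =
  trans (∑-++ (a * b) a f) (cong (ℤ._+ ∑[ s < a ] f (a * b + s)) (∑-blocks a b f))

∣-∑ : ∀ {k} n {f : ℕ → ℤ} → (∀ j → j < n → k ℤ.∣ f j) → k ℤ.∣ ∑< n f
∣-∑ zero    k∣f = ℤ.divides 0ℤ refl
∣-∑ (suc n) k∣f = ∣m∣n⇒∣m+n (∣-∑ n (λ j j<n → k∣f j (m<n⇒m<1+n j<n))) (k∣f n ≤-refl)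

summation-by-parts : ∀ N (V G : ℕ → ℤ)
  → ∑[ i < N ] V i ℤ.* ∑< (suc i) G ≡ ∑< N V ℤ.* ∑< N G ℤ.- ∑[ y < N ] ∑< y V ℤ.* G y
summation-by-parts zero    V G = refl
summation-by-parts (suc N) V G =
  trans (cong (ℤ._+ V N ℤ.* (∑< N G ℤ.+ G N)) (summation-by-parts N V G))
        (regroup (∑< N V) (∑< N G) (∑[ y < N ] ∑< y V ℤ.* G y) (V N) (G N))
  where
  regroup : ∀ a b c v g
    → a ℤ.* b ℤ.- c ℤ.+ v ℤ.* (b ℤ.+ g) ≡ (a ℤ.+ v) ℤ.* (b ℤ.+ g) ℤ.- (c ℤ.+ a ℤ.* g)
  regroup = ℤ-Solver.solve-∀

∣-summation-by-parts : ∀ {q} N (V G : ℕ → ℤ) c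
  → q ℤ.∣ ∑< N V → q ℤ.∣ ∑[ y < N ] ∑< y V ℤ.* G y → q ℤ.∣ ∑[ i < N ] V i ℤ.* (c ℤ.+ ∑< (suc i) G)
∣-summation-by-parts N V G c q∣∑V q∣∑TG = subst (_ ℤ.∣_) (sym expand)
  (∣m∣n⇒∣m+n (∣m⇒∣m*n c q∣∑V) (∣m∣n⇒∣m-n (∣m⇒∣m*n (∑< N G) q∣∑V) q∣∑TG))
  where
  open ≡-Reasoning
  expand : ∑[ i < N ] V i ℤ.* (c ℤ.+ ∑< (suc i) G)
         ≡ ∑< N V ℤ.* c ℤ.+ (∑< N V ℤ.* ∑< N G ℤ.- ∑[ y < N ] ∑< y V ℤ.* G y)
  expand = begin
    ∑[ i < N ] V i ℤ.* (c ℤ.+ ∑< (suc i) G)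
      ≡⟨ ∑-cong N (λ i _ → ℤ.*-distribˡ-+ (V i) c (∑< (suc i) G)) ⟩
    ∑[ i < N ] (V i ℤ.* c ℤ.+ V i ℤ.* ∑< (suc i) G)
      ≡⟨ ∑-+ N _ _ ⟩
    ∑[ i < N ] V i ℤ.* c ℤ.+ ∑[ i < N ] V i ℤ.* ∑< (suc i) G
      ≡⟨ cong₂ ℤ._+_ (∑-*ʳ N c V) (summation-by-parts N V G) ⟩
    ∑< N V ℤ.* c ℤ.+ (∑< N V ℤ.* ∑< N G ℤ.- ∑[ y < N ] ∑< y V ℤ.* G y)
      ∎

Δ : (ℕ → ℤ) → ℕ → ℤ
Δ f x = f (suc x) ℤ.- f x

Δ^ : ℕ → (ℕ → ℤ) → ℕ → ℤ
Δ^ zero    f = f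
Δ^ (suc d) f = Δ^ d (Δ f)

DegreeBelow : ℕ → (ℕ → ℤ) → Set
DegreeBelow d f = ∀ x → Δ^ d f x ≡ 0ℤ

Δ^-cong : ∀ d {f g : ℕ → ℤ} → (∀ x → f x ≡ g x) → ∀ x → Δ^ d f x ≡ Δ^ d g x
Δ^-cong zero    f≗g x = f≗g x
Δ^-cong (suc d) f≗g x = Δ^-cong d (λ y → cong₂ ℤ._-_ (f≗g (suc y)) (f≗g y)) x

Δ^-+ : ∀ d (f g : ℕ → ℤ) x → Δ^ d (λ y → f y ℤ.+ g y) x ≡ Δ^ d f x ℤ.+ Δ^ d g x
Δ^-+ zero    f g x = refl
Δ^-+ (suc d) f g x =
  trans (Δ^-cong d (λ y → interchange (f (suc y)) (g (suc y)) (f y) (g y)) x) (Δ^-+ d (Δ f) (Δ g) x)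
  where
  interchange : ∀ a b c e → (a ℤ.+ b) ℤ.- (c ℤ.+ e) ≡ (a ℤ.- c) ℤ.+ (b ℤ.- e)
  interchange = ℤ-Solver.solve-∀

Δ^-*ʳ : ∀ d (f : ℕ → ℤ) c x → Δ^ d (λ y → f y ℤ.* c) x ≡ Δ^ d f x ℤ.* c
Δ^-*ʳ zero    f c x = refl
Δ^-*ʳ (suc d) f c x = trans (Δ^-cong d (λ y → factor (f (suc y)) (f y) c) x) (Δ^-*ʳ d (Δ f) c x)
  where
  factor : ∀ a b c → a ℤ.* c ℤ.- b ℤ.* c ≡ (a ℤ.- b) ℤ.* c
  factor = ℤ-Solver.solve-∀

Δ^-∑ : ∀ d a (F : ℕ → ℕ → ℤ) x → Δ^ d (λ i → ∑[ s < a ] F s i) x ≡ ∑[ s < a ] Δ^ d (F s) x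
Δ^-∑ d zero    F x = Δ^-0 d x
  where
  Δ^-0 : ∀ d x → Δ^ d (λ _ → 0ℤ) x ≡ 0ℤ
  Δ^-0 zero    x = refl
  Δ^-0 (suc d) x = Δ^-0 d x
Δ^-∑ d (suc a) F x =
  trans (Δ^-+ d (λ i → ∑[ s < a ] F s i) (F a) x) (cong (ℤ._+ Δ^ d (F a) x) (Δ^-∑ d a F x))

∑-Δ : ∀ (f : ℕ → ℤ) x a → f (x + a) ℤ.- f x ≡ ∑[ t < a ] Δ f (x + t)
∑-Δ f x zero    rewrite +-identityʳ x = ℤ.+-inverseʳ (f x)
∑-Δ f x (suc a) rewrite +-suc x a =
  trans (sym (ℤ.+-minus-telescope (f (suc (x + a))) (f (x + a)) (f x)))
        (trans (ℤ.+-comm (Δ f (x + a)) _) (cong (ℤ._+ Δ f (x + a)) (∑-Δ f x a)))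

degreeBelow-∑ : ∀ d a {F : ℕ → ℕ → ℤ} → (∀ s → DegreeBelow d (F s))
  → DegreeBelow d (λ i → ∑[ s < a ] F s i)
degreeBelow-∑ d a {F} deg x = trans (Δ^-∑ d a F x) (trans (∑-cong a (λ s _ → deg s x)) (∑-zero a))

degreeBelow-affine : ∀ d {w : ℕ → ℤ} → DegreeBelow d w → ∀ a c → DegreeBelow d (λ i → w (a * i + c))
degreeBelow-affine zero    deg a c x = deg (a * x + c)
degreeBelow-affine (suc d) {w} deg a c x =
  trans (Δ^-cong d Δ-affine x) (degreeBelow-∑ d a (λ t → degreeBelow-affine d deg a (c + t)) x)
  where
  open ≡-Reasoning
  step : ∀ a i c → a * suc i + c ≡ (a * i + c) + a
  step = ℕ-Solver.solve-∀
  Δ-affine : ∀ i → Δ (λ i → w (a * i + c)) i ≡ ∑[ t < a ] Δ w (a * i + (c + t))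
  Δ-affine i = begin
    w (a * suc i + c) ℤ.- w (a * i + c)  ≡⟨ cong (λ y → w y ℤ.- w (a * i + c)) (step a i c) ⟩
    w (a * i + c + a) ℤ.- w (a * i + c)  ≡⟨ ∑-Δ w (a * i + c) a ⟩
    ∑[ t < a ] Δ w (a * i + c + t)       ≡⟨ ∑-cong a (λ t _ → cong (Δ w) (+-assoc (a * i) c t)) ⟩
    ∑[ t < a ] Δ w (a * i + (c + t))     ∎

degreeBelow-translate : ∀ d {w : ℕ → ℤ} → DegreeBelow d w → ∀ c → DegreeBelow d (λ s → w (c + s))
degreeBelow-translate d {w} deg c x =
  trans (Δ^-cong d (λ s → cong w (trans (+-comm c s) (cong (_+ c) (sym (*-identityˡ s))))) x)
        (degreeBelow-affine d deg 1 c x)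

degreeBelow-prefixSum : ∀ d {V : ℕ → ℤ} → DegreeBelow d V → DegreeBelow (suc d) (λ x → ∑< x V)
degreeBelow-prefixSum d {V} deg x = trans (Δ^-cong d (λ y → cancel (∑< y V) (V y)) x) (deg x)
  where
  cancel : ∀ a b → (a ℤ.+ b) ℤ.- a ≡ b
  cancel = ℤ-Solver.solve-∀

degreeBelow-quotient : ∀ d {V W : ℕ → ℤ} q .{{_ : ℤ.NonZero q}} → (∀ i → W i ≡ V i ℤ.* q)
  → DegreeBelow d W → DegreeBelow d V
degreeBelow-quotient d {V} {W} q W≡Vq deg x = ℤ.*-cancelʳ-≡ (Δ^ d V x) 0ℤ q (begin
  Δ^ d V x ℤ.* q            ≡⟨ Δ^-*ʳ d V q x ⟨
  Δ^ d (λ i → V i ℤ.* q) x  ≡⟨ Δ^-cong d (λ i → sym (W≡Vq i)) x ⟩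
  Δ^ d W x                  ≡⟨ deg x ⟩
  0ℤ                        ≡⟨ ℤ.*-zeroˡ q ⟨
  0ℤ ℤ.* q                  ∎)
  where open ≡-Reasoning

C-absorption : ∀ n k → suc k * (suc n C suc k) ≡ suc n * (n C k)
C-absorption zero    zero    = refl
C-absorption zero    (suc k) = *-zeroʳ (suc (suc k))
C-absorption (suc n) zero    = trans (+-identityʳ _) (trans (nC1≡n (suc (suc n))) (sym (*-identityʳ _)))
C-absorption (suc n) (suc k) = begin
  suc (suc k) * (suc (suc n) C suc (suc k))
    ≡⟨ cong (suc (suc k) *_) (nCk+nC[k+1]≡[n+1]C[k+1] (suc n) (suc k)) ⟨
  suc (suc k) * (B + suc n C suc (suc k))
    ≡⟨ regroup B k (suc n C suc (suc k)) ⟩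
  B + suc k * B + suc (suc k) * (suc n C suc (suc k))
    ≡⟨ cong₂ (λ x y → B + x + y) (C-absorption n k) (C-absorption n (suc k)) ⟩
  B + suc n * (n C k) + suc n * (n C suc k)
    ≡⟨ +-assoc B _ _ ⟩
  B + (suc n * (n C k) + suc n * (n C suc k))
    ≡⟨ cong (λ x → B + x) (*-distribˡ-+ (suc n) (n C k) (n C suc k)) ⟨
  B + suc n * (n C k + n C suc k)
    ≡⟨ cong (λ x → B + suc n * x) (nCk+nC[k+1]≡[n+1]C[k+1] n k) ⟩
  B + suc n * B
    ∎
  where
  open ≡-Reasoning
  B = suc n C suc k
  regroup : ∀ b k c → suc (suc k) * (b + c) ≡ b + suc k * b + suc (suc k) * c
  regroup = ℕ-Solver.solve-∀

∣-C : ∀ {n k} → Coprime n (suc k) → n ∣ n C suc k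
∣-C {zero}  {k} _       = 0 ∣0
∣-C {suc n} {k} coprime =
  coprime-divisor coprime (divides (n C k) (trans (C-absorption n k) (*-comm (suc n) (n C k))))

∑-binomials : ∀ d (c : ℕ → ℤ) {w : ℕ → ℤ} → (∀ x → w x ≡ ∑[ e < d ] c e ℤ.* + (x C e))
  → ∀ N → ∑< N w ≡ ∑[ e < d ] c e ℤ.* + (N C suc e)
∑-binomials d c expand zero    = sym (trans (∑-cong d (λ e _ → ℤ.*-zeroʳ (c e))) (∑-zero d))
∑-binomials d c {w} expand (suc N) = begin
  ∑< N w ℤ.+ w N
    ≡⟨ cong₂ ℤ._+_ (∑-binomials d c expand N) (expand N) ⟩
  ∑[ e < d ] c e ℤ.* + (N C suc e) ℤ.+ ∑[ e < d ] c e ℤ.* + (N C e)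
    ≡⟨ ∑-+ d _ _ ⟨
  ∑[ e < d ] (c e ℤ.* + (N C suc e) ℤ.+ c e ℤ.* + (N C e))
    ≡⟨ ∑-cong d (λ e _ → pascal e) ⟩
  ∑[ e < d ] c e ℤ.* + (suc N C suc e)
    ∎
  where
  open ≡-Reasoning
  pascal : ∀ e → c e ℤ.* + (N C suc e) ℤ.+ c e ℤ.* + (N C e) ≡ c e ℤ.* + (suc N C suc e)
  pascal e = begin
    c e ℤ.* + (N C suc e) ℤ.+ c e ℤ.* + (N C e)
      ≡⟨ ℤ.*-distribˡ-+ (c e) _ _ ⟨
    c e ℤ.* (+ (N C suc e) ℤ.+ + (N C e))
      ≡⟨ cong (ℤ._*_ (c e)) (ℤ.pos-+ (N C suc e) (N C e)) ⟨
    c e ℤ.* + (N C suc e + N C e)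
      ≡⟨ cong (λ x → c e ℤ.* + x) (trans (+-comm (N C suc e) (N C e)) (nCk+nC[k+1]≡[n+1]C[k+1] N e)) ⟩
    c e ℤ.* + (suc N C suc e)
      ∎

newton : ∀ d {w : ℕ → ℤ} → DegreeBelow d w → ∀ x → w x ≡ ∑[ e < d ] Δ^ e w 0 ℤ.* + (x C e)
newton zero    deg x = deg x
newton (suc d) {w} deg x = begin
  w x
    ≡⟨ split (w x) (w 0) ⟩
  w 0 ℤ.+ (w x ℤ.- w 0)
    ≡⟨ cong (ℤ._+_ (w 0)) (∑-Δ w 0 x) ⟩
  w 0 ℤ.+ ∑[ t < x ] Δ w t
    ≡⟨ cong (ℤ._+_ (w 0)) (∑-binomials d (λ e → Δ^ e (Δ w) 0) (newton d deg) x) ⟩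
  w 0 ℤ.+ Σ′
    ≡⟨ cong (ℤ._+ Σ′) (ℤ.*-identityʳ (w 0)) ⟨
  w 0 ℤ.* 1ℤ ℤ.+ Σ′
    ≡⟨ ∑-suc d (λ e → Δ^ e w 0 ℤ.* + (x C e)) ⟨
  ∑[ e < suc d ] Δ^ e w 0 ℤ.* + (x C e)
    ∎
  where
  open ≡-Reasoning
  Σ′ = ∑[ e < d ] Δ^ (suc e) w 0 ℤ.* + (x C suc e)
  split : ∀ a b → a ≡ b ℤ.+ (a ℤ.- b)
  split = ℤ-Solver.solve-∀

≤∧rough⇒rough : ∀ {m n o} → m ≤ n → n Rough o → m Rough o
≤∧rough⇒rough m≤n rough (hasNonTrivialDivisor d<m d∣o) =
  rough (hasNonTrivialDivisor (<-≤-trans d<m m≤n) d∣o)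

rough∧prime∣⇒≤ : ∀ {m n p} → m Rough n → Prime p → p ∣ n → m ≤ p
rough∧prime∣⇒≤ rough pr p∣n = ≮⇒≥ (λ p<m → rough (hasNonTrivialDivisor p<m p∣n))
  where instance _ = prime⇒nonTrivial pr

primeFactors≥⇒rough : ∀ {m n} → (∀ {p} → Prime p → p ∣ n → m ≤ p) → m Rough n
primeFactors≥⇒rough {zero}                bound = 0-rough
primeFactors≥⇒rough {suc zero}            bound = 1-rough
primeFactors≥⇒rough {suc (suc zero)}      bound = 2-rough
primeFactors≥⇒rough {suc m@(suc (suc _))} bound =
  let rough = primeFactors≥⇒rough {m} (λ pr p∣n → <⇒≤ (bound pr p∣n))
  in ∤⇒rough-suc (λ m∣n → n≮n m (bound (rough∧∣⇒prime rough m∣n) m∣n)) rough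

rough-* : ∀ {m a b} → m Rough a → m Rough b → m Rough (a * b)
rough-* {a = a} {b} rough-a rough-b = primeFactors≥⇒rough λ pr p∣ab →
  [ rough∧prime∣⇒≤ rough-a pr , rough∧prime∣⇒≤ rough-b pr ] (euclidsLemma a b pr p∣ab)

rough⇒coprime : ∀ {m n d} → m Rough n → 0 < d → d < m → Coprime n d
rough⇒coprime             rough 0<d d<m {zero}        (_ , 0∣d)   = contradiction (0∣⇒≡0 0∣d) (>⇒≢ 0<d)
rough⇒coprime             rough 0<d d<m {suc zero}    _           = refl
rough⇒coprime {d = suc _} rough 0<d d<m {suc (suc _)} (i∣n , i∣d) =
  contradiction (hasNonTrivialDivisor (≤-<-trans (∣⇒≤ i∣d) d<m) i∣n) rough

rough⇒∣∑ : ∀ d {A} {w : ℕ → ℤ} → suc d Rough A → DegreeBelow d w → + A ℤ.∣ ∑< A w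
rough⇒∣∑ d {A} {w} rough deg rewrite ∑-binomials d (λ e → Δ^ e w 0) (newton d deg) A =
  ∣-∑ d λ e e<d → ∣n⇒∣m*n (Δ^ e w 0)
    (∣ᵤ⇒∣ {i = + (A C suc e)} (∣-C (rough⇒coprime rough (s≤s z≤n) (s≤s e<d))))

sumUpTo-cong : ∀ n {f g : ℕ → ℕ} → (∀ j → j ≤ n → f j ≡ g j) → sumUpTo n f ≡ sumUpTo n g
sumUpTo-cong zero    f≗g = f≗g 0 z≤n
sumUpTo-cong (suc n) f≗g =
  cong₂ _+_ (sumUpTo-cong n (λ j j≤n → f≗g j (m≤n⇒m≤1+n j≤n))) (f≗g (suc n) ≤-refl)

sumUpTo-+ : ∀ n (f g : ℕ → ℕ) → sumUpTo n (λ j → f j + g j) ≡ sumUpTo n f + sumUpTo n g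
sumUpTo-+ zero    f g = refl
sumUpTo-+ (suc n) f g = trans (cong (_+ (f (suc n) + g (suc n))) (sumUpTo-+ n f g))
                              (shuffle (sumUpTo n f) (sumUpTo n g) (f (suc n)) (g (suc n)))
  where
  shuffle : ∀ a b c d → (a + b) + (c + d) ≡ (a + c) + (b + d)
  shuffle = ℕ-Solver.solve-∀

sumUpTo-suc : ∀ n (f : ℕ → ℕ) → sumUpTo (suc n) f ≡ f 0 + sumUpTo n (λ j → f (suc j))
sumUpTo-suc zero    f = refl
sumUpTo-suc (suc n) f = trans (cong (_+ f (suc (suc n))) (sumUpTo-suc n f)) (+-assoc (f 0) _ _)

sumUpTo-ones : ∀ i → sumUpTo i (λ _ → 1) ≡ suc i
sumUpTo-ones zero    = refl
sumUpTo-ones (suc i) = trans (cong (_+ 1) (sumUpTo-ones i)) (+-comm (suc i) 1)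

sumUpTo-zeros : ∀ n {f : ℕ → ℕ} → (∀ j → j ≤ n → f j ≡ 0) → sumUpTo n f ≡ 0
sumUpTo-zeros n zeros = trans (sumUpTo-cong n zeros) (sumUpTo-0 n)
  where
  sumUpTo-0 : ∀ n → sumUpTo n (λ _ → 0) ≡ 0
  sumUpTo-0 zero    = refl
  sumUpTo-0 (suc n) = trans (+-identityʳ _) (sumUpTo-0 n)

sumUpTo-pad : ∀ {b} c {f : ℕ → ℕ} → b ≤ c → (∀ j → b < j → f j ≡ 0) → sumUpTo c f ≡ sumUpTo b f
sumUpTo-pad zero    z≤n   zeros = refl
sumUpTo-pad (suc c) b≤1+c zeros with m≤n⇒m<n∨m≡n b≤1+c
... | inj₁ b<1+c =
  trans (cong₂ _+_ (sumUpTo-pad c (s≤s⁻¹ b<1+c) zeros) (zeros (suc c) b<1+c)) (+-identityʳ _)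
... | inj₂ refl  = refl

pos-sumUpTo : ∀ x (g : ℕ → ℕ) → + sumUpTo x g ≡ ∑[ y < suc x ] + g y
pos-sumUpTo zero    g = sym (ℤ.+-identityˡ (+ g 0))
pos-sumUpTo (suc x) g =
  trans (ℤ.pos-+ (sumUpTo x g) (g (suc x))) (cong (ℤ._+ + g (suc x)) (pos-sumUpTo x g))

strideTerm : ℕ → (ℕ → ℕ) → ℕ → ℕ → ℕ
strideTerm M g n j with j * M ≤? n
... | yes _ = g (n ∸ j * M)
... | no  _ = 0

strideSum : ℕ → (ℕ → ℕ) → ℕ → ℕ
strideSum M g n = sumUpTo n (strideTerm M g n)

strideTerm-≤ : ∀ M g {n} j → j * M ≤ n → strideTerm M g n j ≡ g (n ∸ j * M)
strideTerm-≤ M g {n} j j*M≤n with j * M ≤? n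
... | yes _     = refl
... | no  j*M≰n = contradiction j*M≤n j*M≰n

strideTerm-> : ∀ M g {n} j → n < j * M → strideTerm M g n j ≡ 0
strideTerm-> M g {n} j n<j*M with j * M ≤? n
... | yes j*M≤n = contradiction j*M≤n (<⇒≱ n<j*M)
... | no  _     = refl

strideSum-< : ∀ M g {n} → n < M → strideSum M g n ≡ g n
strideSum-< M g {n} n<M =
  trans (sumUpTo-pad n z≤n λ { (suc j) _ → strideTerm-> M g (suc j) (<-≤-trans n<M (m≤m+n M (j * M))) })
        (strideTerm-≤ M g 0 z≤n)

strideSum-≥ : ∀ M g z → 0 < M → strideSum M g (M + z) ≡ g (M + z) + strideSum M g z
strideSum-≥ (suc M) g z _ =
  trans (sumUpTo-suc (M + z) (strideTerm (suc M) g (suc M + z)))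
        (cong₂ _+_ (strideTerm-≤ (suc M) g 0 z≤n)
                   (trans (sumUpTo-cong (M + z) (λ j _ → strideTerm-suc j))
                          (sumUpTo-pad (M + z) (m≤n+m z M) λ j z<j →
                             strideTerm-> (suc M) g j (<-≤-trans z<j (m≤m*n j (suc M))))))
  where
  strideTerm-suc : ∀ j → strideTerm (suc M) g (suc M + z) (suc j) ≡ strideTerm (suc M) g z j
  strideTerm-suc j with j * suc M ≤? z
  ... | yes j*M≤z = trans (strideTerm-≤ (suc M) g (suc j) (+-monoʳ-≤ (suc M) j*M≤z))
                          (cong g ([m+n]∸[m+o]≡n∸o (suc M) z (j * suc M)))
  ... | no  j*M≰z = strideTerm-> (suc M) g (suc j) (+-monoʳ-< (suc M) (≰⇒> j*M≰z))

delay : ℕ → (ℕ → ℕ) → ℕ → ℕ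
delay M φ y with M ≤? y
... | yes _ = φ (y ∸ M)
... | no  _ = 0

delay-< : ∀ M φ {y} → y < M → delay M φ y ≡ 0
delay-< M φ {y} y<M with M ≤? y
... | yes M≤y = contradiction M≤y (<⇒≱ y<M)
... | no  _   = refl

delay-+ : ∀ M φ z → delay M φ (M + z) ≡ φ z
delay-+ M φ z with M ≤? M + z
... | yes _     = cong φ (m+n∸m≡n M z)
... | no  M≰M+z = contradiction (m≤m+n M z) M≰M+z

sumUpTo-delay : ∀ M φ z → 0 < M → sumUpTo (M + z) (delay M φ) ≡ sumUpTo z φ
sumUpTo-delay (suc M) φ zero    _ =
  cong₂ _+_ (sumUpTo-zeros (M + 0) λ j j≤M+0 →
               delay-< (suc M) φ (s≤s (≤-trans j≤M+0 (≤-reflexive (+-identityʳ M)))))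
            (delay-+ (suc M) φ 0)
sumUpTo-delay (suc M) φ (suc z) 0<M rewrite +-suc M z =
  cong₂ _+_ (sumUpTo-delay (suc M) φ z 0<M)
            (trans (cong (delay (suc M) φ) (sym (+-suc (suc M) z))) (delay-+ (suc M) φ (suc z)))

strideSum-delay : ∀ M g y → 0 < M → strideSum M g y ≡ g y + delay M (strideSum M g) y
strideSum-delay M g y 0<M with M ≤? y
... | no  M≰y = trans (strideSum-< M g (≰⇒> M≰y)) (sym (+-identityʳ (g y)))
... | yes M≤y with m≤n⇒∃[o]m+o≡n M≤y
...   | z , refl =
  trans (strideSum-≥ M g z 0<M) (cong (λ x → g (M + z) + strideSum M g x) (sym (m+n∸m≡n M z)))

sumUpTo-strideSum : ∀ M h z → 0 < M
  → sumUpTo (M + z) (strideSum M h) ≡ sumUpTo (M + z) h + sumUpTo z (strideSum M h)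
sumUpTo-strideSum M h z 0<M = begin
  sumUpTo (M + z) (strideSum M h)
    ≡⟨ sumUpTo-cong (M + z) (λ y _ → strideSum-delay M h y 0<M) ⟩
  sumUpTo (M + z) (λ y → h y + delay M (strideSum M h) y)
    ≡⟨ sumUpTo-+ (M + z) h _ ⟩
  sumUpTo (M + z) h + sumUpTo (M + z) (delay M (strideSum M h))
    ≡⟨ cong (λ x → sumUpTo (M + z) h + x) (sumUpTo-delay M (strideSum M h) z 0<M) ⟩
  sumUpTo (M + z) h + sumUpTo z (strideSum M h)
    ∎
  where open ≡-Reasoning

strideSum-ones : ∀ a {g : ℕ → ℕ} → (∀ y → g y ≡ 1)
  → ∀ i s → s < a → strideSum a g (a * i + s) ≡ suc i
strideSum-ones a {g} ones zero    s s<a =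
  trans (cong (λ x → strideSum a g (x + s)) (*-zeroʳ a)) (trans (strideSum-< a g s<a) (ones s))
strideSum-ones a {g} ones (suc i) s s<a = begin
  strideSum a g (a * suc i + s)                    ≡⟨ cong (strideSum a g) (peel a i s) ⟩
  strideSum a g (a + (a * i + s))                  ≡⟨ strideSum-≥ a g (a * i + s) (≤-<-trans z≤n s<a) ⟩
  g (a + (a * i + s)) + strideSum a g (a * i + s)  ≡⟨ cong₂ _+_ (ones _) (strideSum-ones a ones i s s<a) ⟩
  suc (suc i)                                      ∎
  where
  open ≡-Reasoning
  peel : ∀ a i s → a * suc i + s ≡ a + (a * i + s)
  peel = ℕ-Solver.solve-∀

strideSum-blocks : ∀ a M {F h : ℕ → ℕ} → 0 < M
  → (∀ i s → s < a → F (a * i + s) ≡ sumUpTo i h)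
  → ∀ i s → s < a → strideSum (a * M) F (a * i + s) ≡ sumUpTo i (strideSum M h)
strideSum-blocks a M {F} {h} 0<M blocks i = go i (<-wellFounded i)
  where
  open ≡-Reasoning
  regroup : ∀ a M z s → a * (M + z) + s ≡ a * M + (a * z + s)
  regroup = ℕ-Solver.solve-∀
  go : ∀ i → Acc _<_ i → ∀ s → s < a → strideSum (a * M) F (a * i + s) ≡ sumUpTo i (strideSum M h)
  go i _ s s<a with <-≤-connex i M
  ... | inj₁ i<M = begin
    strideSum (a * M) F (a * i + s)  ≡⟨ strideSum-< (a * M) F (<-≤-trans (+-monoʳ-< (a * i) s<a) a*[1+i]≤a*M) ⟩
    F (a * i + s)                    ≡⟨ blocks i s s<a ⟩
    sumUpTo i h                      ≡⟨ sumUpTo-cong i (λ y y≤i → strideSum-< M h (≤-<-trans y≤i i<M)) ⟨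
    sumUpTo i (strideSum M h)        ∎
    where
    a*[1+i]≤a*M : a * i + a ≤ a * M
    a*[1+i]≤a*M = ≤-trans (≤-reflexive (trans (+-comm (a * i) a) (sym (*-suc a i)))) (*-monoʳ-≤ a i<M)
  go i (acc rec) s s<a | inj₂ M≤i with m≤n⇒∃[o]m+o≡n M≤i
  ... | z , refl = begin
    strideSum (a * M) F (a * (M + z) + s)
      ≡⟨ cong (strideSum (a * M) F) (regroup a M z s) ⟩
    strideSum (a * M) F (a * M + (a * z + s))
      ≡⟨ strideSum-≥ (a * M) F (a * z + s) (*-mono-≤ (≤-<-trans z≤n s<a) 0<M) ⟩
    F (a * M + (a * z + s)) + strideSum (a * M) F (a * z + s)
      ≡⟨ cong (λ x → F x + strideSum (a * M) F (a * z + s)) (regroup a M z s) ⟨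
    F (a * (M + z) + s) + strideSum (a * M) F (a * z + s)
      ≡⟨ cong₂ _+_ (blocks (M + z) s s<a) (go z (rec (m<n+m z 0<M)) s s<a) ⟩
    sumUpTo (M + z) h + sumUpTo z (strideSum M h)
      ≡⟨ sumUpTo-strideSum M h z 0<M ⟨
    sumUpTo (M + z) (strideSum M h)
      ∎

-- The summands of partsUpTo are local with-functions of Defs and cannot be named;
-- summandOf recovers one from the unfolding of partsUpTo by unification.
summandOf : ∀ {x} n {f : ℕ → ℕ} → x ≡ sumUpTo n f → ℕ → ℕ
summandOf _ {f} _ = f

partsUpTo-suc : ∀ m K n → partsUpTo m (suc K) n ≡ strideSum (Mprod m (suc K)) (partsUpTo m K) n
partsUpTo-suc m K n = sumUpTo-cong n (λ j _ → summand≡strideTerm j)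
  where
  summand≡strideTerm : ∀ j → summandOf n (refl {x = partsUpTo m (suc K) n}) j
                           ≡ strideTerm (Mprod m (suc K)) (partsUpTo m K) n j
  summand≡strideTerm j with j * Mprod m (suc K) ≤? n
  ... | yes _ = refl
  ... | no  _ = refl

partsUpTo-zero : ∀ m → m 0 ≡ 1 → ∀ n → partsUpTo m zero n ≡ 1
partsUpTo-zero m m0≡1 = count
  where
  summand : ℕ → ℕ → ℕ
  summand n = summandOf n (refl {x = partsUpTo m zero n})
  c*m0≡c : ∀ c → c * m 0 ≡ c
  c*m0≡c c = trans (cong (c *_) m0≡1) (*-identityʳ c)
  summand-self : ∀ n → summand n n ≡ 1
  summand-self n with n * m 0 ≟ n
  ... | yes _      = refl
  ... | no  n*m0≢n = contradiction (c*m0≡c n) n*m0≢n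
  summand-< : ∀ {n} c → c < n → summand n c ≡ 0
  summand-< {n} c c<n with c * m 0 ≟ n
  ... | yes c*m0≡n = contradiction (trans (sym (c*m0≡c c)) c*m0≡n) (<⇒≢ c<n)
  ... | no  _      = refl
  count : ∀ n → partsUpTo m zero n ≡ 1
  count zero    = summand-self 0
  count (suc n) = cong₂ _+_ (sumUpTo-zeros n (λ c c≤n → summand-< c (s≤s c≤n))) (summand-self (suc n))

shift : (ℕ → ℕ) → ℕ → ℕ
shift m zero    = 1
shift m (suc t) = m (suc (suc t))

Mprod-suc : ∀ m → m 0 ≡ 1 → ∀ K → Mprod m (suc K) ≡ m 1 * Mprod (shift m) K
Mprod-suc m m0≡1 zero    = trans (cong (_* m 1) m0≡1) (trans (+-identityʳ (m 1)) (sym (*-identityʳ (m 1))))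
Mprod-suc m m0≡1 (suc K) = trans (cong (_* m (2 + K)) (Mprod-suc m m0≡1 K)) (*-assoc (m 1) _ (m (2 + K)))

prodFrom-shift : ∀ m i len → prodFrom (shift m) (suc i) len ≡ prodFrom m (2 + i) len
prodFrom-shift m i zero      = refl
prodFrom-shift m i (suc len) = cong (m (2 + i) *_) (prodFrom-shift m (suc i) len)

prodFrom-closed : ∀ (P : ℕ → Set) → P 1 → (∀ {x y} → P x → P y → P (x * y))
  → ∀ f i len → (∀ j → i ≤ j → P (f j)) → P (prodFrom f i len)
prodFrom-closed P P1 P* f i zero      Pf = P1
prodFrom-closed P P1 P* f i (suc len) Pf =
  P* (Pf i ≤-refl) (prodFrom-closed P P1 P* f (suc i) len (λ j i<j → Pf j (<⇒≤ i<j)))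

record Admissible (d : ℕ) (a : ℕ → ℕ) : Set where
  field
    head≡1   : a 0 ≡ 1
    positive : ∀ t → 0 < a (suc t)
    rough    : ∀ t → (suc t + d) Rough a (suc t)

primeFactors≥⇒admissible : ∀ {m} → m 0 ≡ 1 → (∀ j → 1 ≤ j → 2 ≤ m j)
  → (∀ t p → 1 ≤ t → Prime p → p ∣ m t → t ≤ p) → Admissible 0 m
primeFactors≥⇒admissible m0≡1 m≥2 primeFactors≥ = record
  { head≡1   = m0≡1
  ; positive = λ t → <-trans z<s (m≥2 (suc t) (s≤s z≤n))
  ; rough    = λ t → primeFactors≥⇒rough λ prime p∣m →
                 ≤-trans (≤-reflexive (+-identityʳ (suc t))) (primeFactors≥ (suc t) _ (s≤s z≤n) prime p∣m)
  }

shift-admissible : ∀ {d a} → Admissible d a → Admissible (suc d) (shift a)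
shift-admissible {d} adm = record
  { head≡1   = refl
  ; positive = λ t → positive (suc t)
  ; rough    = λ t → ≤∧rough⇒rough (≤-reflexive (+-suc (suc t) d)) (rough (suc t))
  }
  where open Admissible adm

Mprod-positive : ∀ {d a} → Admissible d a → ∀ K → 0 < Mprod a K
Mprod-positive adm zero    = ≤-reflexive (sym (Admissible.head≡1 adm))
Mprod-positive adm (suc K) = *-mono-≤ (Mprod-positive adm K) (Admissible.positive adm K)

prodFrom-positive : ∀ {d a} → Admissible d a → ∀ {i} r → 0 < prodFrom a (suc i) r
prodFrom-positive adm {i} r =
  prodFrom-closed (0 <_) z<s *-mono-≤ _ (suc i) r λ { (suc t) _ → Admissible.positive adm t }

prodFrom-rough : ∀ {d a} → Admissible d a → ∀ r → suc d Rough prodFrom a 1 r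
prodFrom-rough {d} adm r = prodFrom-closed (suc d Rough_) (rough-1 _) rough-* _ 1 r
  λ { (suc t) _ → ≤∧rough⇒rough (s≤s (m≤n+m d t)) (Admissible.rough adm t) }

partsUpTo-block : ∀ {d a} → Admissible d a → ∀ K i s → s < a 1
  → partsUpTo a (suc K) (a 1 * i + s) ≡ sumUpTo i (partsUpTo (shift a) K)
partsUpTo-block {a = a} adm zero i s s<a₁ = begin
  partsUpTo a 1 (a 1 * i + s)
    ≡⟨ partsUpTo-suc a 0 (a 1 * i + s) ⟩
  strideSum (Mprod a 1) (partsUpTo a 0) (a 1 * i + s)
    ≡⟨ cong (λ M → strideSum M (partsUpTo a 0) (a 1 * i + s))
            (trans (Mprod-suc a head≡1 0) (*-identityʳ (a 1))) ⟩
  strideSum (a 1) (partsUpTo a 0) (a 1 * i + s)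
    ≡⟨ strideSum-ones (a 1) (partsUpTo-zero a head≡1) i s s<a₁ ⟩
  suc i
    ≡⟨ trans (sumUpTo-cong i (λ y _ → partsUpTo-zero (shift a) refl y)) (sumUpTo-ones i) ⟨
  sumUpTo i (partsUpTo (shift a) 0)
    ∎
  where
  open ≡-Reasoning
  open Admissible adm
partsUpTo-block {a = a} adm (suc K) i s s<a₁ = begin
  partsUpTo a (2 + K) (a 1 * i + s)
    ≡⟨ partsUpTo-suc a (suc K) (a 1 * i + s) ⟩
  strideSum (Mprod a (2 + K)) (partsUpTo a (suc K)) (a 1 * i + s)
    ≡⟨ cong (λ M → strideSum M (partsUpTo a (suc K)) (a 1 * i + s))
            (Mprod-suc a (Admissible.head≡1 adm) (suc K)) ⟩
  strideSum (a 1 * M′) (partsUpTo a (suc K)) (a 1 * i + s)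
    ≡⟨ strideSum-blocks (a 1) M′ (Mprod-positive (shift-admissible adm) (suc K))
                         (partsUpTo-block adm K) i s s<a₁ ⟩
  sumUpTo i (strideSum M′ (partsUpTo (shift a) K))
    ≡⟨ sumUpTo-cong i (λ y _ → partsUpTo-suc (shift a) K y) ⟨
  sumUpTo i (partsUpTo (shift a) (suc K))
    ∎
  where
  open ≡-Reasoning
  M′ = Mprod (shift a) (suc K)

blockSum : (ℕ → ℕ) → ℕ → (ℕ → ℤ) → ℕ → ℕ → ℤ
blockSum a K w A n = ∑[ j < A ] w j ℤ.* + partsUpTo a K (A * n + j)

blockSum-split : ∀ {d a} → Admissible d a → ∀ K (w : ℕ → ℤ) Q n
  → blockSum a (suc K) w (a 1 * Q) n
  ≡ ∑[ i < Q ] (∑[ s < a 1 ] w (a 1 * i + s)) ℤ.* + sumUpTo (Q * n + i) (partsUpTo (shift a) K)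
blockSum-split {a = a} adm K w Q n = trans (∑-blocks (a 1) Q _) (∑-cong Q (λ i _ → block i))
  where
  open ≡-Reasoning
  g = partsUpTo (shift a) K
  regroup : ∀ a Q n i s → a * Q * n + (a * i + s) ≡ a * (Q * n + i) + s
  regroup = ℕ-Solver.solve-∀
  block : ∀ i → ∑[ s < a 1 ] w (a 1 * i + s) ℤ.* + partsUpTo a (suc K) (a 1 * Q * n + (a 1 * i + s))
              ≡ (∑[ s < a 1 ] w (a 1 * i + s)) ℤ.* + sumUpTo (Q * n + i) g
  block i = begin
    ∑[ s < a 1 ] w (a 1 * i + s) ℤ.* + partsUpTo a (suc K) (a 1 * Q * n + (a 1 * i + s))
      ≡⟨ ∑-cong (a 1) (λ s s<a₁ → cong (λ x → w (a 1 * i + s) ℤ.* + x)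
           (trans (cong (partsUpTo a (suc K)) (regroup (a 1) Q n i s)) (partsUpTo-block adm K (Q * n + i) s s<a₁))) ⟩
    ∑[ s < a 1 ] w (a 1 * i + s) ℤ.* + sumUpTo (Q * n + i) g
      ≡⟨ ∑-*ʳ (a 1) _ (λ s → w (a 1 * i + s)) ⟩
    (∑[ s < a 1 ] w (a 1 * i + s)) ℤ.* + sumUpTo (Q * n + i) g
      ∎

blockSum-step : ∀ {d a} → Admissible d a → ∀ K (w : ℕ → ℤ) → DegreeBelow d w → ∀ Q n → suc d Rough Q
  → (∀ T → DegreeBelow (suc d) T → + Q ℤ.∣ blockSum (shift a) K T Q n)
  → + (a 1 * Q) ℤ.∣ blockSum a (suc K) w (a 1 * Q) n
blockSum-step {d} {a} adm K w deg Q n Q-rough Q∣shifted =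
  subst₂ ℤ._∣_ (sym (ℤ.pos-* (a 1) Q)) (sym factor-a₁) (*-monoʳ-∣ (+ a 1) Q∣∑VH)
  where
  open ≡-Reasoning
  open Admissible adm
  g = partsUpTo (shift a) K
  G : ℕ → ℤ
  G y = + g (Q * n + y)
  base = ∑[ y < Q * n ] + g y
  a₁∣W : ∀ i → + a 1 ℤ.∣ ∑[ s < a 1 ] w (a 1 * i + s)
  a₁∣W i = rough⇒∣∑ d (rough 0) (degreeBelow-translate d deg (a 1 * i))
  V : ℕ → ℤ
  V i = ℤ.quotient (a₁∣W i)
  degV : DegreeBelow d V
  degV = degreeBelow-quotient d (+ a 1) {{>-nonZero (positive 0)}} (λ i → ℤ._∣_.equality (a₁∣W i))
           (degreeBelow-∑ d (a 1) (λ s → degreeBelow-affine d deg (a 1) s))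
  Q∣∑VH : + Q ℤ.∣ ∑[ i < Q ] V i ℤ.* (base ℤ.+ ∑< (suc i) G)
  Q∣∑VH = ∣-summation-by-parts Q V G base (rough⇒∣∑ d Q-rough degV)
            (Q∣shifted (λ y → ∑< y V) (degreeBelow-prefixSum d degV))
  prefix-split : ∀ i → + sumUpTo (Q * n + i) g ≡ base ℤ.+ ∑< (suc i) G
  prefix-split i = trans (pos-sumUpTo (Q * n + i) g)
    (trans (cong (λ x → ∑[ y < x ] + g y) (sym (+-suc (Q * n) i))) (∑-++ (Q * n) (suc i) (λ y → + g y)))
  swap : ∀ v a h → v ℤ.* a ℤ.* h ≡ a ℤ.* (v ℤ.* h)
  swap = ℤ-Solver.solve-∀
  factor-a₁ : blockSum a (suc K) w (a 1 * Q) n ≡ + a 1 ℤ.* (∑[ i < Q ] V i ℤ.* (base ℤ.+ ∑< (suc i) G))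
  factor-a₁ = begin
    blockSum a (suc K) w (a 1 * Q) n
      ≡⟨ blockSum-split adm K w Q n ⟩
    ∑[ i < Q ] (∑[ s < a 1 ] w (a 1 * i + s)) ℤ.* + sumUpTo (Q * n + i) g
      ≡⟨ ∑-cong Q (λ i _ → cong₂ ℤ._*_ (ℤ._∣_.equality (a₁∣W i)) (prefix-split i)) ⟩
    ∑[ i < Q ] V i ℤ.* + a 1 ℤ.* (base ℤ.+ ∑< (suc i) G)
      ≡⟨ ∑-cong Q (λ i _ → swap (V i) (+ a 1) (base ℤ.+ ∑< (suc i) G)) ⟩
    ∑[ i < Q ] + a 1 ℤ.* (V i ℤ.* (base ℤ.+ ∑< (suc i) G))
      ≡⟨ ∑-*ˡ Q (+ a 1) _ ⟩
    + a 1 ℤ.* (∑[ i < Q ] V i ℤ.* (base ℤ.+ ∑< (suc i) G))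
      ∎

blockSum-divisible : ∀ r {d a} → Admissible d a → ∀ K (w : ℕ → ℤ) → DegreeBelow d w → ∀ n
  → + prodFrom a 1 r ℤ.∣ blockSum a K w (prodFrom a 1 r) n
blockSum-divisible zero    adm K w deg n = ∣ᵤ⇒∣ (1∣ _)
blockSum-divisible (suc r) {d} {a} adm zero w deg n =
  subst (_ ℤ.∣_) (∑-cong A (λ j _ → weight-only j)) (rough⇒∣∑ d (prodFrom-rough adm (suc r)) deg)
  where
  A = prodFrom a 1 (suc r)
  weight-only : ∀ j → w j ≡ w j ℤ.* + partsUpTo a zero (A * n + j)
  weight-only j = trans (sym (ℤ.*-identityʳ (w j)))
    (cong (λ x → w j ℤ.* + x) (sym (partsUpTo-zero a (Admissible.head≡1 adm) (A * n + j))))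
blockSum-divisible (suc r) {d} {a} adm (suc K) w deg n =
  subst (λ Q → + (a 1 * Q) ℤ.∣ blockSum a (suc K) w (a 1 * Q) n) (prodFrom-shift a 0 r)
    (blockSum-step adm K w deg (prodFrom (shift a) 1 r) n
      (≤∧rough⇒rough (n≤1+n (suc d)) (prodFrom-rough (shift-admissible adm) r))
      (λ T degT → blockSum-divisible r (shift-admissible adm) K T degT n))

∑-partsUpTo-divisible : ∀ r {a} → Admissible 0 a → ∀ K N
  → + prodFrom a 2 r ℤ.∣ ∑[ y < prodFrom a 2 r * N ] + partsUpTo (shift a) K y
∑-partsUpTo-divisible r {a} adm K N
  rewrite sym (prodFrom-shift a 0 r) | ∑-blocks (prodFrom (shift a) 1 r) N (λ y → + partsUpTo (shift a) K y) =
  ∣-∑ N λ i _ → subst (_ ℤ.∣_) (∑-cong (prodFrom (shift a) 1 r) (λ j _ → ℤ.*-identityˡ _))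
                  (blockSum-divisible r (shift-admissible adm) K (λ _ → 1ℤ) (λ _ → refl) i)

*[1+u]∸1 : ∀ {a} u → 1 < a → a * suc u ∸ 1 ≡ suc (a * u + (a ∸ 2))
*[1+u]∸1 {suc (suc v)} u (s≤s (s≤s _)) = arith u v
  where
  arith : ∀ u v → u + suc v * suc u ≡ suc (suc (suc v) * u + v)
  arith = ℕ-Solver.solve-∀

pM-pred-multiple : ∀ {d a} → Admissible d a → 1 < a 1 → ∀ u
  → pM a (a 1 * suc u ∸ 1) ≡ sumUpTo u (partsUpTo (shift a) (a 1 * u + (a 1 ∸ 2)))
pM-pred-multiple {a = a} adm 1<a₁ u rewrite *[1+u]∸1 u 1<a₁ =
  trans (cong (partsUpTo a (suc K)) (sym (+-suc (a 1 * u) (a 1 ∸ 2))))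
        (partsUpTo-block adm K u (suc (a 1 ∸ 2)) (1+[x∸2]<x 1<a₁))
  where
  K = a 1 * u + (a 1 ∸ 2)
  1+[x∸2]<x : ∀ {x} → 1 < x → suc (x ∸ 2) < x
  1+[x∸2]<x (s≤s (s≤s _)) = ≤-refl

mainTheorem2 : (m : ℕ → ℕ) → m 0 ≡ 1 → (∀ j → 1 ≤ j → 2 ≤ m j)
    → (∀ t p → 1 ≤ t → Prime p → p ∣ m t → t ≤ p)
    → (n r : ℕ) → 1 ≤ n → 1 ≤ r
    → prodFrom m 2 (r ∸ 1) ∣ pM m (prodFrom m 1 r * n ∸ 1)
mainTheorem2 m m0≡1 m≥2 primeFactors≥ (suc n) (suc r) _ _ =
  subst (Q ∣_) (sym pM≡sumUpTo)
    (∣⇒∣ᵤ (subst (+ Q ℤ.∣_) (sym +sumUpTo≡∑) (∑-partsUpTo-divisible r adm K (suc n))))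
  where
  adm = primeFactors≥⇒admissible m0≡1 m≥2 primeFactors≥
  Q = prodFrom m 2 r
  u = Q * suc n ∸ 1
  1+u≡Q[1+n] : suc u ≡ Q * suc n
  1+u≡Q[1+n] = m+[n∸m]≡n (*-mono-≤ (prodFrom-positive adm r) z<s)
  K = m 1 * u + (m 1 ∸ 2)
  pM≡sumUpTo : pM m (m 1 * Q * suc n ∸ 1) ≡ sumUpTo u (partsUpTo (shift m) K)
  pM≡sumUpTo =
    trans (cong (λ x → pM m (x ∸ 1)) (trans (*-assoc (m 1) Q (suc n)) (cong (m 1 *_) (sym 1+u≡Q[1+n]))))
          (pM-pred-multiple adm (m≥2 1 (s≤s z≤n)) u)
  +sumUpTo≡∑ : + sumUpTo u (partsUpTo (shift m) K) ≡ ∑[ y < Q * suc n ] + partsUpTo (shift m) K y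
  +sumUpTo≡∑ = trans (pos-sumUpTo u _) (cong (λ x → ∑[ y < x ] + partsUpTo (shift m) K y) 1+u≡Q[1+n])
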